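{- Let $k$ be a positive integer and let $\varphi$ be a graded modal formula of modal depth at most $k$ in a modal vocabulary $\sigma$. The following are equivalent: (1) $\varphi$ is preserved under homomorphisms between pointed Kripke structures; (2) $\varphi$ is logically equivalent (over all pointed Kripke structures) to an existential positive modal formula of modal depth at most $k$.
   Context: A modal vocabulary is a relational vocabulary all of whose relation symbols have arity at most 2; its structures are Kripke structures, and a pointed Kripke structure is a pair $(\mathcal{A},a)$ with $a\in\mathcal{A}$. Each unary symbol $P$ gives a propositional variable $p$ (true at $a$ iff $a\in P^{\mathcal{A}}$) and each binary symbol $R$ gives modalities $\Diamond_R,\Box_R$ with accessibility relation $R^{\mathcal{A}}$. Graded modal formulas may additionally use graded modalities $\Diamond_R^n$, $\Box_R^n$ ($n\ge 0$), where $\mathcal{A},a\models\Diamond_R^n\psi$ iff at least $n$ $R$-successors of $a$ satisfy $\psi$, and $\Box_R^n\psi=\neg\Diamond_R^n\neg\psi$. The modal depth of a formula is the maximum number of nested modalities (graded or not). An existential positive modal formula is a (non-graded) modal formula built using only $\vee$, $\wedge$ and diamond modalities $\Diamond_R$. A homomorphism of pointed Kripke structures $(\mathcal{A},a)\to(\mathcal{B},b)$ is a $\sigma$-homomorphism $h$ with $h(a)=b$; $\varphi$ is preserved under homomorphisms if $\mathcal{A},a\models\varphi$ and such an $h$ exists imply $\mathcal{B},b\models\varphi$. -}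

module Defs where

open import Data.Nat using (ℕ; zero; suc; _⊔_)
open import Data.Fin using (Fin)
open import Data.Product using (Σ; _×_; _,_)
open import Data.Sum using (_⊎_)
open import Data.Unit using (⊤)
open import Data.Empty using (⊥)
open import Relation.Nullary using (¬_)
open import Relation.Binary.PropositionalEquality using (_≡_)
open import Function.Definitions using (Injective)
open import Function.Bundles using (_⇔_)

-- A modal vocabulary: a set of unary relation symbols and a set of binary
-- relation symbols (nullary symbols play no role in modal formulas).
record Vocabulary : Set₁ where
  field
    Unary  : Set
    Binary : Set
open Vocabulary public

record Kripke (σ : Vocabulary) : Set₁ where
  field
    Carrier : Set
    UnRel   : Unary σ → Carrier → Set
    BinRel  : Binary σ → Carrier → Carrier → Set
open Kripke public

data Fm (σ : Vocabulary) : Set where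
  ⊤'     : Fm σ
  ⊥'     : Fm σ
  var    : Unary σ → Fm σ
  ¬'_    : Fm σ → Fm σ
  _∧'_   : Fm σ → Fm σ → Fm σ
  _∨'_   : Fm σ → Fm σ → Fm σ
  ◇      : Binary σ → Fm σ → Fm σ
  □      : Binary σ → Fm σ → Fm σ
  ◇[_]   : ℕ → Binary σ → Fm σ → Fm σ
  □[_]   : ℕ → Binary σ → Fm σ → Fm σ

md : ∀ {σ} → Fm σ → ℕ
md ⊤'          = zero
md ⊥'          = zero
md (var p)     = zero
md (¬' φ)      = md φ
md (φ ∧' ψ)    = md φ ⊔ md ψ
md (φ ∨' ψ)    = md φ ⊔ md ψ
md (◇ R φ)     = suc (md φ)
md (□ R φ)     = suc (md φ)
md (◇[ n ] R φ) = suc (md φ)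
md (□[ n ] R φ) = suc (md φ)

_,_⊨_ : ∀ {σ} (𝒜 : Kripke σ) → Carrier 𝒜 → Fm σ → Set
𝒜 , a ⊨ ⊤'       = ⊤
𝒜 , a ⊨ ⊥'       = ⊥
𝒜 , a ⊨ var p    = UnRel 𝒜 p a
𝒜 , a ⊨ (¬' φ)   = ¬ (𝒜 , a ⊨ φ)
𝒜 , a ⊨ (φ ∧' ψ) = (𝒜 , a ⊨ φ) × (𝒜 , a ⊨ ψ)
𝒜 , a ⊨ (φ ∨' ψ) = (𝒜 , a ⊨ φ) ⊎ (𝒜 , a ⊨ ψ)
𝒜 , a ⊨ ◇ R φ    = Σ (Carrier 𝒜) λ b → BinRel 𝒜 R a b × (𝒜 , b ⊨ φ)
𝒜 , a ⊨ □ R φ    = ∀ b → BinRel 𝒜 R a b → 𝒜 , b ⊨ φ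
-- at least n R-successors satisfy φ: an injective family of n such successors
𝒜 , a ⊨ ◇[ n ] R φ =
  Σ (Fin n → Carrier 𝒜) λ f → Injective _≡_ _≡_ f ×
    (∀ i → BinRel 𝒜 R a (f i) × (𝒜 , f i ⊨ φ))
𝒜 , a ⊨ □[ n ] R φ =
  ¬ (Σ (Fin n → Carrier 𝒜) λ f → Injective _≡_ _≡_ f ×
       (∀ i → BinRel 𝒜 R a (f i) × ¬ (𝒜 , f i ⊨ φ)))

data IsExPos {σ : Vocabulary} : Fm σ → Set where
  ep-⊤   : IsExPos ⊤'
  ep-⊥   : IsExPos ⊥'
  ep-var : ∀ p → IsExPos (var p)
  ep-∧   : ∀ {φ ψ} → IsExPos φ → IsExPos ψ → IsExPos (φ ∧' ψ)
  ep-∨   : ∀ {φ ψ} → IsExPos φ → IsExPos ψ → IsExPos (φ ∨' ψ)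
  ep-◇   : ∀ {φ} R → IsExPos φ → IsExPos (◇ R φ)

record PointedHom {σ} (𝒜 : Kripke σ) (a : Carrier 𝒜)
                      (ℬ : Kripke σ) (b : Carrier ℬ) : Set where
  field
    h      : Carrier 𝒜 → Carrier ℬ
    h-un   : ∀ p x → UnRel 𝒜 p x → UnRel ℬ p (h x)
    h-bin  : ∀ R x y → BinRel 𝒜 R x y → BinRel ℬ R (h x) (h y)
    h-pt   : h a ≡ b

PreservedUnderHom : ∀ {σ} → Fm σ → Set₁
PreservedUnderHom {σ} φ =
  ∀ (𝒜 : Kripke σ) a (ℬ : Kripke σ) b →
    𝒜 , a ⊨ φ → PointedHom 𝒜 a ℬ b → ℬ , b ⊨ φ

_≡ₗ_ : ∀ {σ} → Fm σ → Fm σ → Set₁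
_≡ₗ_ {σ} φ ψ = ∀ (𝒜 : Kripke σ) a → (𝒜 , a ⊨ φ) ⇔ (𝒜 , a ⊨ ψ)

-- Classical metatheory (the paper's setting): excluded middle for Set.
ExcludedMiddle : Set₁
ExcludedMiddle = (P : Set) → P ⊎ ¬ P

{-# OPTIONS --safe #-}
module Submission where

-- (2) ⇒ (1): existential positive formulas are preserved by homomorphisms.
-- (1) ⇒ (2): work over the finitely many symbols occurring in φ. Depth-d types (the atoms true
-- at a point and, for each binary symbol, the depth-(d − 1) types of its successors) form a
-- finite set; each type t has an existential positive characteristic formula χ d t of depth d,
-- and the types themselves form a canonical structure. A positive k-step simulation from (A, a)
-- to (B, b) yields a homomorphism from the depth-k unravelling of (A, a) into (B, b); being
-- tree-like, the unravelling agrees with (A, a) on graded formulas of depth ≤ k, so a formula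
-- preserved under homomorphisms passes along such simulations. There is one from every (A, a)
-- to its type in the canonical structure, and one from a type t to every point satisfying
-- χ k t; hence φ is equivalent to the disjunction of the χ k t over the types t at which φ
-- holds in the canonical structure.

open import Defs
open import Data.Nat using (ℕ; _≤_)
open import Data.Product using (Σ; _×_)
open import Function.Bundles using (_⇔_)

open import Data.Bool using (Bool; true; false; T; if_then_else_)
open import Data.Empty using (⊥-elim)
open import Data.Fin using (Fin; zero; suc)
open import Data.List as L using (List; []; _∷_; _++_; [_]; length; cartesianProduct)
open import Data.List.Membership.Propositional using (_∈_)
open import Data.List.Membership.Propositional.Properties
  using (∈-map⁺; ∈-map⁻; ∈-cartesianProduct⁺; ∈-filter⁺; ∈-filter⁻)
open import Data.List.Relation.Binary.Subset.Propositional using (_⊆_)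
open import Data.List.Relation.Binary.Subset.Propositional.Properties
  using (⊆-refl; ⊆-trans; xs⊆xs++ys; xs⊆ys++xs)
open import Data.List.Relation.Unary.Any using (here; there; index)
open import Data.List.Relation.Unary.Any.Properties using (lookup-index)
open import Data.Nat using (zero; suc; z≤n; s≤s)
open import Data.Nat.Properties using (⊔-lub; m⊔n≤o⇒m≤o; m⊔n≤o⇒n≤o; suc-injective)
open import Data.Product using (_,_; proj₁; proj₂; uncurry)
open import Data.Product.Function.NonDependent.Propositional using (_×-⇔_)
open import Data.Sum using (_⊎_; inj₁; inj₂)
open import Data.Sum.Function.Propositional using (_⊎-⇔_)
open import Data.Unit using (⊤; tt)
open import Data.Vec as V using (Vec)
open import Data.Vec.Properties using (lookup∘tabulate)
open import Function using (_∘_; case_of_)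
open import Function.Bundles using (mk⇔; Equivalence)
open import Function.Construct.Identity using (⇔-id)
open import Function.Definitions using (Injective)
open import Function.Related.TypeIsomorphisms using (¬-cong-⇔)
open import Relation.Binary.PropositionalEquality using (_≡_; refl; sym; trans; cong; subst; subst₂)
open import Relation.Nullary using (¬_; Dec)
open import Relation.Nullary.Decidable using (fromSum; isYes; toWitness; fromWitness)

open Equivalence using (to; from)

decide : ExcludedMiddle → (P : Set) → Dec P
decide lem P = fromSum (lem P)

-- A , a ⊨ ◇[ n ] R ψ unfolds to AtLeast n (λ y → BinRel A R a y × A , y ⊨ ψ).
AtLeast : ℕ → {X : Set} → (X → Set) → Set
AtLeast n {X} P = Σ (Fin n → X) λ f → Injective _≡_ _≡_ f × (∀ i → P (f i))

AtLeast-map : ∀ {n} {X Y : Set} (P : X → Set) (Q : Y → Set) (g : X → Y) →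
  (∀ {x x′} → P x → P x′ → g x ≡ g x′ → x ≡ x′) → (∀ {x} → P x → Q (g x)) →
  AtLeast n P → AtLeast n Q
AtLeast-map P Q g g-inj g-PQ (f , f-inj , Pf) =
  g ∘ f , (λ eq → f-inj (g-inj (Pf _) (Pf _) eq)) , λ i → g-PQ (Pf i)

++⊆⇒⊆ˡ : {A : Set} {xs ys zs : List A} → xs ++ ys ⊆ zs → xs ⊆ zs
++⊆⇒⊆ˡ = ⊆-trans (xs⊆xs++ys _ _)

++⊆⇒⊆ʳ : {A : Set} {xs ys zs : List A} → xs ++ ys ⊆ zs → ys ⊆ zs
++⊆⇒⊆ʳ = ⊆-trans (xs⊆ys++xs _ _)

record Finite : Set₁ where
  field
    Elem     : Set
    elems    : List Elem
    complete : ∀ x → x ∈ elems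

  size : ℕ
  size = length elems

  nth : Fin size → Elem
  nth = L.lookup elems
open Finite

⊤ᶠ : Finite
⊤ᶠ = record { Elem = ⊤ ; elems = [ tt ] ; complete = λ _ → here refl }

Boolᶠ : Finite
Boolᶠ = record { Elem = Bool ; elems = true ∷ false ∷ [] ; complete = λ
  { true → here refl ; false → there (here refl) } }

_×ᶠ_ : Finite → Finite → Finite
F ×ᶠ G = record
  { Elem = Elem F × Elem G
  ; elems = cartesianProduct (elems F) (elems G)
  ; complete = λ (x , y) → ∈-cartesianProduct⁺ (complete F x) (complete G y) }

vectors : {A : Set} → List A → (n : ℕ) → List (Vec A n)
vectors xs zero = [ V.[] ]
vectors xs (suc n) = L.map (uncurry V._∷_) (cartesianProduct xs (vectors xs n))

∈-vectors : {A : Set} {xs : List A} → (∀ x → x ∈ xs) → ∀ {n} (v : Vec A n) → v ∈ vectors xs n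
∈-vectors all V.[] = here refl
∈-vectors all (x V.∷ v) =
  ∈-map⁺ (uncurry V._∷_) (∈-cartesianProduct⁺ (all x) (∈-vectors all v))

Vecᶠ : Finite → ℕ → Finite
Vecᶠ F n = record
  { Elem = Vec (Elem F) n ; elems = vectors (elems F) n ; complete = ∈-vectors (complete F) }

module _ {σ : Vocabulary} where

  ⋀ : ∀ {N} → (Fin N → Fm σ) → Fm σ
  ⋀ {zero} f = ⊤'
  ⋀ {suc N} f = f zero ∧' ⋀ (f ∘ suc)

  ⋁ : List (Fm σ) → Fm σ
  ⋁ [] = ⊥'
  ⋁ (ψ ∷ ψs) = ψ ∨' ⋁ ψs

  guard : Bool → Fm σ → Fm σ
  guard b ψ = if b then ψ else ⊤'

  ExPos≤ : ℕ → Fm σ → Set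
  ExPos≤ d ψ = IsExPos ψ × md ψ ≤ d

  ∧-ExPos≤ : ∀ {d ψ χ} → ExPos≤ d ψ → ExPos≤ d χ → ExPos≤ d (ψ ∧' χ)
  ∧-ExPos≤ (e , m) (e′ , m′) = ep-∧ e e′ , ⊔-lub m m′

  ∨-ExPos≤ : ∀ {d ψ χ} → ExPos≤ d ψ → ExPos≤ d χ → ExPos≤ d (ψ ∨' χ)
  ∨-ExPos≤ (e , m) (e′ , m′) = ep-∨ e e′ , ⊔-lub m m′

  ◇-ExPos≤ : ∀ {d ψ} R → ExPos≤ d ψ → ExPos≤ (suc d) (◇ R ψ)
  ◇-ExPos≤ R (e , m) = ep-◇ R e , s≤s m

  ⋀-ExPos≤ : ∀ {N d} (f : Fin N → Fm σ) → (∀ i → ExPos≤ d (f i)) → ExPos≤ d (⋀ f)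
  ⋀-ExPos≤ {zero} f ep = ep-⊤ , z≤n
  ⋀-ExPos≤ {suc N} f ep = ∧-ExPos≤ (ep zero) (⋀-ExPos≤ (f ∘ suc) (ep ∘ suc))

  ⋁-ExPos≤ : ∀ {d} ψs → (∀ {ψ} → ψ ∈ ψs → ExPos≤ d ψ) → ExPos≤ d (⋁ ψs)
  ⋁-ExPos≤ [] ep = ep-⊥ , z≤n
  ⋁-ExPos≤ (ψ ∷ ψs) ep = ∨-ExPos≤ (ep (here refl)) (⋁-ExPos≤ ψs (ep ∘ there))

  guard-ExPos≤ : ∀ b {d ψ} → ExPos≤ d ψ → ExPos≤ d (guard b ψ)
  guard-ExPos≤ true ep = ep
  guard-ExPos≤ false _ = ep-⊤ , z≤n

  module _ {𝒜 : Kripke σ} {x : Carrier 𝒜} where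

    ⊨⋀⁺ : ∀ {N} (f : Fin N → Fm σ) → (∀ i → 𝒜 , x ⊨ f i) → 𝒜 , x ⊨ ⋀ f
    ⊨⋀⁺ {zero} f s = tt
    ⊨⋀⁺ {suc N} f s = s zero , ⊨⋀⁺ (f ∘ suc) (s ∘ suc)

    ⊨⋀⁻ : ∀ {N} (f : Fin N → Fm σ) → 𝒜 , x ⊨ ⋀ f → ∀ i → 𝒜 , x ⊨ f i
    ⊨⋀⁻ f (s , _) zero = s
    ⊨⋀⁻ f (_ , s) (suc i) = ⊨⋀⁻ (f ∘ suc) s i

    ⊨⋁⁺ : ∀ {ψ} ψs → ψ ∈ ψs → 𝒜 , x ⊨ ψ → 𝒜 , x ⊨ ⋁ ψs
    ⊨⋁⁺ (ψ ∷ _) (here refl) s = inj₁ s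
    ⊨⋁⁺ (_ ∷ ψs) (there ψ∈) s = inj₂ (⊨⋁⁺ ψs ψ∈ s)

    ⊨⋁⁻ : ∀ ψs → 𝒜 , x ⊨ ⋁ ψs → Σ (Fm σ) λ ψ → ψ ∈ ψs × 𝒜 , x ⊨ ψ
    ⊨⋁⁻ (ψ ∷ ψs) (inj₁ s) = ψ , here refl , s
    ⊨⋁⁻ (ψ ∷ ψs) (inj₂ s) with ⊨⋁⁻ ψs s
    ... | χ , χ∈ , s′ = χ , there χ∈ , s′

    ⊨guard⁺ : ∀ b {ψ} → (T b → 𝒜 , x ⊨ ψ) → 𝒜 , x ⊨ guard b ψ
    ⊨guard⁺ true s = s tt
    ⊨guard⁺ false s = tt

    ⊨guard⁻ : ∀ b {ψ} → 𝒜 , x ⊨ guard b ψ → T b → 𝒜 , x ⊨ ψ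
    ⊨guard⁻ true s _ = s

  exPos-preserved : ∀ {ψ} → IsExPos ψ → ∀ {𝒜 ℬ : Kripke σ} {a b} (H : PointedHom 𝒜 a ℬ b) →
    ∀ x → 𝒜 , x ⊨ ψ → ℬ , PointedHom.h H x ⊨ ψ
  exPos-preserved ep-⊤ H x s = tt
  exPos-preserved ep-⊥ H x ()
  exPos-preserved (ep-var p) H x s = PointedHom.h-un H p x s
  exPos-preserved (ep-∧ e e′) H x (s , s′) = exPos-preserved e H x s , exPos-preserved e′ H x s′
  exPos-preserved (ep-∨ e e′) H x (inj₁ s) = inj₁ (exPos-preserved e H x s)
  exPos-preserved (ep-∨ e e′) H x (inj₂ s) = inj₂ (exPos-preserved e′ H x s)
  exPos-preserved (ep-◇ R e) H x (y , r , s) =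
    PointedHom.h H y , PointedHom.h-bin H R x y r , exPos-preserved e H y s

  equivalent-to-exPos⇒preserved : ∀ {φ ψ} → IsExPos ψ → φ ≡ₗ ψ → PreservedUnderHom φ
  equivalent-to-exPos⇒preserved {ψ = ψ} ep φ≡ψ 𝒜 a ℬ b s H =
    from (φ≡ψ ℬ b) (subst (λ y → ℬ , y ⊨ ψ) (PointedHom.h-pt H)
      (exPos-preserved ep H a (to (φ≡ψ 𝒜 a) s)))

  unarySymbols : Fm σ → List (Unary σ)
  unarySymbols ⊤' = []
  unarySymbols ⊥' = []
  unarySymbols (var p) = [ p ]
  unarySymbols (¬' ψ) = unarySymbols ψ
  unarySymbols (ψ ∧' χ) = unarySymbols ψ ++ unarySymbols χ
  unarySymbols (ψ ∨' χ) = unarySymbols ψ ++ unarySymbols χ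
  unarySymbols (◇ R ψ) = unarySymbols ψ
  unarySymbols (□ R ψ) = unarySymbols ψ
  unarySymbols (◇[ n ] R ψ) = unarySymbols ψ
  unarySymbols (□[ n ] R ψ) = unarySymbols ψ

  binarySymbols : Fm σ → List (Binary σ)
  binarySymbols ⊤' = []
  binarySymbols ⊥' = []
  binarySymbols (var p) = []
  binarySymbols (¬' ψ) = binarySymbols ψ
  binarySymbols (ψ ∧' χ) = binarySymbols ψ ++ binarySymbols χ
  binarySymbols (ψ ∨' χ) = binarySymbols ψ ++ binarySymbols χ
  binarySymbols (◇ R ψ) = R ∷ binarySymbols ψ
  binarySymbols (□ R ψ) = R ∷ binarySymbols ψ
  binarySymbols (◇[ n ] R ψ) = R ∷ binarySymbols ψ
  binarySymbols (□[ n ] R ψ) = R ∷ binarySymbols ψ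

module Restricted {σ : Vocabulary} (us : List (Unary σ)) (bs : List (Binary σ)) where

  record Simulation (A : Kripke σ) (a : Carrier A) (B : Kripke σ) (b : Carrier B) (k : ℕ) : Set₁ where
    field
      Z     : ℕ → Carrier A → Carrier B → Set
      root  : Z k a b
      atom  : ∀ {d x y p} → Z d x y → p ∈ us → UnRel A p x → UnRel B p y
      forth : ∀ {d x y R x′} → Z (suc d) x y → R ∈ bs → BinRel A R x x′ →
              Σ (Carrier B) λ y′ → BinRel B R y y′ × Z d x′ y′

  module Unravelling (A : Kripke σ) (a : Carrier A) (k : ℕ) where

    Path : Set
    Path = List (Binary σ × Carrier A)

    end : Path → Carrier A
    end [] = a
    end ((R , x) ∷ q) = x

    -- Valid d q: q is a path from a along edges labelled in bs, of length k − d.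
    Valid : ℕ → Path → Set
    Valid d [] = d ≡ k
    Valid d ((R , x) ∷ q) = Valid (suc d) q × R ∈ bs × BinRel A R (end q) x

    IsValid : Path → Set
    IsValid q = Σ ℕ λ d → Valid d q

    valid-unique : ∀ {d d′} q → Valid d q → Valid d′ q → d ≡ d′
    valid-unique [] v v′ = trans v (sym v′)
    valid-unique (_ ∷ q) (v , _) (v′ , _) = suc-injective (valid-unique q v v′)

    data Edge (R : Binary σ) (q : Path) : Path → Set where
      edge : ∀ {d} x → Valid d ((R , x) ∷ q) → Edge R q ((R , x) ∷ q)

    unravelling : Kripke σ
    unravelling = record
      { Carrier = Path
      ; UnRel   = λ p q → IsValid q × p ∈ us × UnRel A p (end q)
      ; BinRel  = Edge }

    module ModalStep {d q R} (ψ : Fm σ) (v : Valid (suc d) q) (r : R ∈ bs)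
      (ih : ∀ {x} → Valid d ((R , x) ∷ q) → (unravelling , (R , x) ∷ q ⊨ ψ) ⇔ (A , x ⊨ ψ)) where

      edge-injective : ∀ {q₁ q₂} → Edge R q q₁ → Edge R q q₂ → end q₁ ≡ end q₂ → q₁ ≡ q₂
      edge-injective (edge _ _) (edge _ _) refl = refl

      ◇-⇔ : (unravelling , q ⊨ ◇ R ψ) ⇔ (A , end q ⊨ ◇ R ψ)
      ◇-⇔ = mk⇔
        (λ { (_ , edge x (_ , _ , e) , s) → x , e , to (ih (v , r , e)) s })
        (λ (x , e , s) → (R , x) ∷ q , edge x (v , r , e) , from (ih (v , r , e)) s)

      □-⇔ : (unravelling , q ⊨ □ R ψ) ⇔ (A , end q ⊨ □ R ψ)
      □-⇔ = mk⇔
        (λ s x e → to (ih (v , r , e)) (s _ (edge x (v , r , e))))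
        (λ { s _ (edge x (_ , _ , e)) → from (ih (v , r , e)) (s x e) })

      atLeast⁻ : ∀ {n} (P : Path → Set) (Q : Carrier A → Set) →
        (∀ {x} (e : BinRel A R (end q) x) → P ((R , x) ∷ q) → Q x) →
        AtLeast n (λ q′ → Edge R q q′ × P q′) → AtLeast n (λ x → BinRel A R (end q) x × Q x)
      atLeast⁻ P Q PQ =
        AtLeast-map (λ q′ → Edge R q q′ × P q′) (λ x → BinRel A R (end q) x × Q x) end
          (λ (ε₁ , _) (ε₂ , _) → edge-injective ε₁ ε₂)
          (λ { (edge x (_ , _ , e) , p) → e , PQ e p })

      atLeast⁺ : ∀ {n} (P : Path → Set) (Q : Carrier A → Set) →
        (∀ {x} (e : BinRel A R (end q) x) → Q x → P ((R , x) ∷ q)) →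
        AtLeast n (λ x → BinRel A R (end q) x × Q x) → AtLeast n (λ q′ → Edge R q q′ × P q′)
      atLeast⁺ P Q QP =
        AtLeast-map (λ x → BinRel A R (end q) x × Q x) (λ q′ → Edge R q q′ × P q′) (λ x → (R , x) ∷ q)
          (λ _ _ → cong end)
          (λ {x} (e , p) → edge x (v , r , e) , QP e p)

      ◇[]-⇔ : ∀ n → (unravelling , q ⊨ ◇[ n ] R ψ) ⇔ (A , end q ⊨ ◇[ n ] R ψ)
      ◇[]-⇔ n = mk⇔
        (atLeast⁻ (unravelling ,_⊨ ψ) (A ,_⊨ ψ) λ e → to (ih (v , r , e)))
        (atLeast⁺ (unravelling ,_⊨ ψ) (A ,_⊨ ψ) λ e → from (ih (v , r , e)))

      □[]-⇔ : ∀ n → (unravelling , q ⊨ □[ n ] R ψ) ⇔ (A , end q ⊨ □[ n ] R ψ)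
      □[]-⇔ n = ¬-cong-⇔ (mk⇔
        (atLeast⁻ (λ q′ → ¬ (unravelling , q′ ⊨ ψ)) (λ x → ¬ (A , x ⊨ ψ))
          λ e ns → ns ∘ from (ih (v , r , e)))
        (atLeast⁺ (λ q′ → ¬ (unravelling , q′ ⊨ ψ)) (λ x → ¬ (A , x ⊨ ψ))
          λ e ns → ns ∘ to (ih (v , r , e))))

    unravelling-⊨ : ∀ ψ {d q} → unarySymbols ψ ⊆ us → binarySymbols ψ ⊆ bs →
      Valid d q → md ψ ≤ d → (unravelling , q ⊨ ψ) ⇔ (A , end q ⊨ ψ)
    unravelling-⊨ ⊤' _ _ _ _ = ⇔-id _
    unravelling-⊨ ⊥' _ _ _ _ = ⇔-id _
    unravelling-⊨ (var p) su _ v _ = mk⇔ (λ (_ , _ , u) → u) (λ u → (_ , v) , su (here refl) , u)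
    unravelling-⊨ (¬' ψ) su sb v le = ¬-cong-⇔ (unravelling-⊨ ψ su sb v le)
    unravelling-⊨ (ψ ∧' χ) su sb v le =
      unravelling-⊨ ψ (++⊆⇒⊆ˡ su) (++⊆⇒⊆ˡ sb) v (m⊔n≤o⇒m≤o _ _ le) ×-⇔
      unravelling-⊨ χ (++⊆⇒⊆ʳ su) (++⊆⇒⊆ʳ sb) v (m⊔n≤o⇒n≤o _ _ le)
    unravelling-⊨ (ψ ∨' χ) su sb v le =
      unravelling-⊨ ψ (++⊆⇒⊆ˡ su) (++⊆⇒⊆ˡ sb) v (m⊔n≤o⇒m≤o _ _ le) ⊎-⇔
      unravelling-⊨ χ (++⊆⇒⊆ʳ su) (++⊆⇒⊆ʳ sb) v (m⊔n≤o⇒n≤o _ _ le)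
    unravelling-⊨ (◇ R ψ) {suc d} su sb v (s≤s le) = ◇-⇔
      where open ModalStep ψ v (sb (here refl)) (λ v′ → unravelling-⊨ ψ su (sb ∘ there) v′ le)
    unravelling-⊨ (□ R ψ) {suc d} su sb v (s≤s le) = □-⇔
      where open ModalStep ψ v (sb (here refl)) (λ v′ → unravelling-⊨ ψ su (sb ∘ there) v′ le)
    unravelling-⊨ (◇[ n ] R ψ) {suc d} su sb v (s≤s le) = ◇[]-⇔ n
      where open ModalStep ψ v (sb (here refl)) (λ v′ → unravelling-⊨ ψ su (sb ∘ there) v′ le)
    unravelling-⊨ (□[ n ] R ψ) {suc d} su sb v (s≤s le) = □[]-⇔ n
      where open ModalStep ψ v (sb (here refl)) (λ v′ → unravelling-⊨ ψ su (sb ∘ there) v′ le)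

    module _ (lem : ExcludedMiddle) {B : Kripke σ} {b : Carrier B} (S : Simulation A a B b k) where
      open Simulation S

      Tracks : Path → Carrier B → Set
      Tracks q y = ∀ {d} → Valid d q → Z d (end q) y

      -- Invalid paths are sent to the image of their parent; they carry no atoms or edges.
      extend : ∀ {R x q} → Σ (Carrier B) (Tracks q) →
        IsValid ((R , x) ∷ q) ⊎ ¬ IsValid ((R , x) ∷ q) → Σ (Carrier B) (Tracks ((R , x) ∷ q))
      extend {q = q} (y , tracks) (inj₁ (d , v , r , e)) with forth (tracks v) r e
      ... | y′ , _ , z = y′ , λ (v′ , _) →
        subst (λ d → Z d _ y′) (suc-injective (valid-unique q v v′)) z
      extend (y , _) (inj₂ invalid) = y , λ v → ⊥-elim (invalid (_ , v))

      track : (q : Path) → Σ (Carrier B) (Tracks q)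
      track [] = b , λ { refl → root }
      track ((R , x) ∷ q) = extend (track q) (lem (IsValid ((R , x) ∷ q)))

      track-edge : ∀ {R q q′} → Edge R q q′ → BinRel B R (proj₁ (track q)) (proj₁ (track q′))
      track-edge {R} {q} (edge x w) with lem (IsValid ((R , x) ∷ q))
      ... | inj₁ (d , v , r , e) = proj₁ (proj₂ (forth (proj₂ (track q) v) r e))
      ... | inj₂ invalid = ⊥-elim (invalid (_ , w))

      unravelling-hom : PointedHom unravelling [] B b
      unravelling-hom = record
        { h     = proj₁ ∘ track
        ; h-un  = λ p q ((_ , v) , p∈ , u) → atom (proj₂ (track q) v) p∈ u
        ; h-bin = λ R q q′ → track-edge
        ; h-pt  = refl }

  preserved-along-simulation : ExcludedMiddle → ∀ {k} φ → PreservedUnderHom φ →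
    unarySymbols φ ⊆ us → binarySymbols φ ⊆ bs → md φ ≤ k →
    ∀ {A a B b} → Simulation A a B b k → A , a ⊨ φ → B , b ⊨ φ
  preserved-along-simulation lem {k} φ pres su sb mdφ {A} {a} {B} {b} S s =
    pres unravelling [] B b (from (unravelling-⊨ φ su sb refl mdφ) s) (unravelling-hom lem S)
    where open Unravelling A a k

  n m : ℕ
  n = length us
  m = length bs

  entry : ∀ {l} → Vec (Vec Bool l) m → Fin m → Fin l → Bool
  entry s j i = V.lookup (V.lookup s j) i

  -- Bit i of a type's first component says whether the i-th symbol of us holds; entry (j , i)
  -- of its second says whether some successor along the j-th symbol of bs has the i-th type
  -- of depth d − 1.
  Types : ℕ → Finite
  Successors : ℕ → Finite
  Types d = Vecᶠ Boolᶠ n ×ᶠ Successors d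
  Successors zero = ⊤ᶠ
  Successors (suc d) = Vecᶠ (Vecᶠ Boolᶠ (size (Types d))) m

  Tp : ℕ → Set
  Tp d = Elem (Types d)

  atomsFm : Vec Bool n → Fm σ
  atomsFm u = ⋀ λ i → guard (V.lookup u i) (var (L.lookup us i))

  χ : ∀ d → Tp d → Fm σ
  successorsFm : ∀ d → Elem (Successors d) → Fm σ
  χ d (u , s) = atomsFm u ∧' successorsFm d s
  successorsFm zero _ = ⊤'
  successorsFm (suc d) s =
    ⋀ λ j → ⋀ λ i → guard (entry s j i) (◇ (L.lookup bs j) (χ d (nth (Types d) i)))

  atomsFm-ExPos≤ : ∀ {d} u → ExPos≤ d (atomsFm u)
  atomsFm-ExPos≤ u = ⋀-ExPos≤ _ λ i → guard-ExPos≤ (V.lookup u i) (ep-var _ , z≤n)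

  χ-ExPos≤ : ∀ d t → ExPos≤ d (χ d t)
  successorsFm-ExPos≤ : ∀ d s → ExPos≤ d (successorsFm d s)
  χ-ExPos≤ d (u , s) = ∧-ExPos≤ (atomsFm-ExPos≤ u) (successorsFm-ExPos≤ d s)
  successorsFm-ExPos≤ zero _ = ep-⊤ , z≤n
  successorsFm-ExPos≤ (suc d) s = ⋀-ExPos≤ _ λ j → ⋀-ExPos≤ _ λ i →
    guard-ExPos≤ (entry s j i) (◇-ExPos≤ (L.lookup bs j) (χ-ExPos≤ d (nth (Types d) i)))

  data CanonicalEdge : Binary σ → Σ ℕ Tp → Σ ℕ Tp → Set where
    edge : ∀ {d u s} j i → T (entry s j i) →
      CanonicalEdge (L.lookup bs j) (suc d , u , s) (d , nth (Types d) i)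

  canonical : Kripke σ
  canonical = record
    { Carrier = Σ ℕ Tp
    ; UnRel   = λ p (_ , u , _) → Σ (p ∈ us) λ p∈ → T (V.lookup u (index p∈))
    ; BinRel  = CanonicalEdge }

  T-lookup-decided : (lem : ExcludedMiddle) → ∀ {N} (P : Fin N → Set) i →
    T (V.lookup (V.tabulate λ i → isYes (decide lem (P i))) i) ⇔ P i
  T-lookup-decided lem P i rewrite lookup∘tabulate (λ i → isYes (decide lem (P i))) i =
    mk⇔ toWitness fromWitness

  module TypeOf (lem : ExcludedMiddle) (A : Kripke σ) where

    atomsAt : Carrier A → Vec Bool n
    atomsAt x = V.tabulate λ i → isYes (decide lem (UnRel A (L.lookup us i) x))

    tp : ∀ d → Carrier A → Tp d
    successorsAt : ∀ d → Carrier A → Elem (Successors d)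
    HasSuccessorOfType : ∀ d → Carrier A → Fin m → Tp d → Set
    tp d x = atomsAt x , successorsAt d x
    successorsAt zero x = tt
    successorsAt (suc d) x = V.tabulate λ j → V.tabulate λ i →
      isYes (decide lem (HasSuccessorOfType d x j (nth (Types d) i)))
    HasSuccessorOfType d x j t = Σ (Carrier A) λ y → BinRel A (L.lookup bs j) x y × tp d y ≡ t

    T-successorsAt : ∀ d x j i →
      T (entry (successorsAt (suc d) x) j i) ⇔ HasSuccessorOfType d x j (nth (Types d) i)
    T-successorsAt d x j i =
      subst (λ row → T (V.lookup row i) ⇔ HasSuccessorOfType d x j (nth (Types d) i))
        (sym (lookup∘tabulate _ j))
      (T-lookup-decided lem (HasSuccessorOfType d x j ∘ nth (Types d)) i)

    ⊨atomsFm : ∀ x → A , x ⊨ atomsFm (atomsAt x)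
    ⊨atomsFm x = ⊨⋀⁺ (λ i → guard (V.lookup (atomsAt x) i) (var (L.lookup us i))) λ i →
      ⊨guard⁺ (V.lookup (atomsAt x) i) (to (T-lookup-decided lem (λ i → UnRel A (L.lookup us i) x) i))

    ⊨χ-tp : ∀ d x → A , x ⊨ χ d (tp d x)
    ⊨successorsFm : ∀ d x → A , x ⊨ successorsFm d (successorsAt d x)
    ⊨χ-tp d x = ⊨atomsFm x , ⊨successorsFm d x
    ⊨successorsFm zero x = tt
    ⊨successorsFm (suc d) x = ⊨⋀⁺ _ λ j → ⊨⋀⁺ _ λ i → ⊨guard⁺ _ λ bit →
      let (y , e , tp≡) = to (T-successorsAt d x j i) bit
      in y , e , subst (λ t → A , y ⊨ χ d t) tp≡ (⊨χ-tp d y)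

    tp-edge : ∀ {d R x x′} → R ∈ bs → BinRel A R x x′ →
      CanonicalEdge R (suc d , tp (suc d) x) (d , tp d x′)
    tp-edge {d} {R} {x} {x′} r e =
      subst₂ (λ R t → CanonicalEdge R (suc d , tp (suc d) x) (d , t))
        (sym (lookup-index r)) (sym (lookup-index x′∈))
        (edge (index r) (index x′∈) (from (T-successorsAt d x (index r) (index x′∈))
          (x′ , subst (λ R → BinRel A R x x′) (lookup-index r) e , lookup-index x′∈)))
      where x′∈ = complete (Types d) (tp d x′)

    tp-simulation : ∀ {k} a → Simulation A a canonical (k , tp k a) k
    tp-simulation a = record
      { Z     = λ d x c → c ≡ (d , tp d x)
      ; root  = refl
      ; atom  = λ { {x = x} refl p∈ u →
          p∈ , from (T-lookup-decided lem _ (index p∈)) (subst (λ p → UnRel A p x) (lookup-index p∈) u) }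
      ; forth = λ { refl r e → _ , tp-edge r e , refl } }

  χ-simulation : ∀ {k t B b} → B , b ⊨ χ k t → Simulation canonical (k , t) B b k
  χ-simulation {t = t} {B = B} sat = record
    { Z     = λ d c y → Σ (Tp d) λ t → c ≡ (d , t) × B , y ⊨ χ d t
    ; root  = t , refl , sat
    ; atom  = λ { {y = y} (_ , refl , sa , _) _ (p∈ , bit) →
        subst (λ p → UnRel B p y) (sym (lookup-index p∈)) (⊨guard⁻ _ (⊨⋀⁻ _ sa (index p∈)) bit) }
    ; forth = λ { (_ , refl , _ , ss) _ (edge j i bit) →
        let (y′ , e , s) = ⊨guard⁻ _ (⊨⋀⁻ _ (⊨⋀⁻ _ ss j) i) bit in y′ , e , (_ , refl , s) } }

  module NormalForm (lem : ExcludedMiddle) {k} (φ : Fm σ) (pres : PreservedUnderHom φ)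
    (su : unarySymbols φ ⊆ us) (sb : binarySymbols φ ⊆ bs) (mdφ : md φ ≤ k) where

    realised : Tp k → Set
    realised t = canonical , (k , t) ⊨ φ

    realisedTypes : List (Tp k)
    realisedTypes = L.filter (decide lem ∘ realised) (elems (Types k))

    ∈-realisedTypes⁺ : ∀ {t} → realised t → t ∈ realisedTypes
    ∈-realisedTypes⁺ {t} = ∈-filter⁺ (decide lem ∘ realised) (complete (Types k) t)

    ∈-realisedTypes⁻ : ∀ {t} → t ∈ realisedTypes → realised t
    ∈-realisedTypes⁻ = proj₂ ∘ ∈-filter⁻ (decide lem ∘ realised) {xs = elems (Types k)}

    normalForm : Fm σ
    normalForm = ⋁ (L.map (χ k) realisedTypes)

    normalForm-ExPos≤ : ExPos≤ k normalForm
    normalForm-ExPos≤ = ⋁-ExPos≤ _ λ ψ∈ → case ∈-map⁻ (χ k) ψ∈ of λ { (t , _ , refl) → χ-ExPos≤ k t }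

    transfer : ∀ {A a B b} → Simulation A a B b k → A , a ⊨ φ → B , b ⊨ φ
    transfer = preserved-along-simulation lem φ pres su sb mdφ

    ≡ₗ-normalForm : φ ≡ₗ normalForm
    ≡ₗ-normalForm A a = mk⇔ forward backward
      where
        open TypeOf lem A

        forward : A , a ⊨ φ → A , a ⊨ normalForm
        forward s = ⊨⋁⁺ (L.map (χ k) realisedTypes)
          (∈-map⁺ (χ k) (∈-realisedTypes⁺ (transfer (tp-simulation a) s))) (⊨χ-tp k a)

        backward : A , a ⊨ normalForm → A , a ⊨ φ
        backward s with ⊨⋁⁻ (L.map (χ k) realisedTypes) s
        ... | ψ , ψ∈ , sψ with ∈-map⁻ (χ k) ψ∈
        ... | t , t∈ , refl = transfer (χ-simulation sψ) (∈-realisedTypes⁻ t∈)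

theorem4p9 : ExcludedMiddle → (σ : Vocabulary) (k : ℕ) → 1 ≤ k →
    (φ : Fm σ) → md φ ≤ k →
    PreservedUnderHom φ ⇔ Σ (Fm σ) (λ ψ → IsExPos ψ × md ψ ≤ k × (φ ≡ₗ ψ))
theorem4p9 lem σ k _ φ mdφ = mk⇔
  (λ pres → let open NormalForm lem φ pres ⊆-refl ⊆-refl mdφ in
    normalForm , proj₁ normalForm-ExPos≤ , proj₂ normalForm-ExPos≤ , ≡ₗ-normalForm)
  (λ (ψ , ep , _ , φ≡ψ) → equivalent-to-exPos⇒preserved {φ = φ} ep φ≡ψ)
  where open Restricted (unarySymbols φ) (binarySymbols φ)
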